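{- Let $G$ be a connected graph of order $n\ge 2$ and let $H$ be a connected graph with at least two vertices and root vertex $v$. Then $$\gamma_c(G\circ H)\in\{\,n\gamma_c(H),\ n(\gamma_c(H)+1)\,\}.$$
   Context: All graphs are finite, simple and undirected. A connected dominating set of a connected graph $G$ is a set $D$ of vertices such that every vertex outside $D$ has a neighbor in $D$ and the subgraph induced by $D$ is connected; $\gamma_c(G)$ is the minimum cardinality of a connected dominating set. For $G$ with vertex set $\{v_1,\dots,v_n\}$ and $H$ with root $v$, the rooted product $G\circ H$ is obtained from one copy of $G$ and $n$ copies $H_1,\dots,H_n$ of $H$ by identifying each $v_i$ with the copy of $v$ in $H_i$. -}

module Defs where

open import Data.Nat using (ℕ; suc; _≤_; _*_; _+_)
open import Data.Fin using (Fin; remQuot)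
open import Data.Fin.Subset using (Subset; _∈_; _∉_; ∣_∣)
open import Data.Product using (Σ; ∃; _×_; _,_; proj₁; proj₂)
open import Data.Sum using (_⊎_)
open import Data.Empty using (⊥)
open import Relation.Nullary using (¬_)
open import Relation.Binary.PropositionalEquality using (_≡_)

record Graph (n : ℕ) : Set₁ where
  field
    Adj   : Fin n → Fin n → Set
    adj-sym : ∀ {u v} → Adj u v → Adj v u
    adj-irrefl : ∀ {u} → ¬ Adj u u
open Graph public using (Adj)

data WalkIn {n : ℕ} (G : Graph n) (S : Subset n) : Fin n → Fin n → Set where
  here : ∀ {u} → u ∈ S → WalkIn G S u u
  step : ∀ {u w v} → u ∈ S → Adj G u w → WalkIn G S w v → WalkIn G S u v

InducedConnected : ∀ {n} → Graph n → Subset n → Set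
InducedConnected {n} G S =
  (∃ λ (u : Fin n) → u ∈ S) × (∀ u v → u ∈ S → v ∈ S → WalkIn G S u v)

full : ∀ {n} → Subset n
full = Data.Fin.Subset.⊤
  where import Data.Fin.Subset

Connected : ∀ {n} → Graph n → Set
Connected G = InducedConnected G full

Dominating : ∀ {n} → Graph n → Subset n → Set
Dominating {n} G D = ∀ (u : Fin n) → u ∉ D → ∃ λ w → w ∈ D × Adj G u w

ConnectedDominatingSet : ∀ {n} → Graph n → Subset n → Set
ConnectedDominatingSet G D = Dominating G D × InducedConnected G D

-- D is a minimum connected dominating set; then ∣ D ∣ = γ_c(G).
IsMinCDS : ∀ {n} → Graph n → Subset n → Set
IsMinCDS G D = ConnectedDominatingSet G D ×
  (∀ D' → ConnectedDominatingSet G D' → ∣ D ∣ ≤ ∣ D' ∣)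

-- Vertex set Fin (n * m); the
-- vertex with remQuot-decomposition (i , a) is vertex a of the copy H_i.
-- (i,a) ~ (j,b)  iff  (i = j and a ~_H b)  or  (a = b = r and i ~_G j).
RPAdj : ∀ {n m} → Graph n → Graph m → Fin m → Fin n × Fin m → Fin n × Fin m → Set
RPAdj G H r (i , a) (j , b) =
  (i ≡ j × Adj H a b) ⊎ (a ≡ r × b ≡ r × Adj G i j)

rootedProduct : ∀ {n m} → Graph n → (H : Graph m) → Fin m → Graph (n * m)
rootedProduct {n} {m} G H r = record
  { Adj = λ x y → RPAdj G H r (remQuot m x) (remQuot m y)
  ; adj-sym = symm
  ; adj-irrefl = irr
  }
  where
  open import Relation.Binary.PropositionalEquality using (sym)
  open import Data.Sum using (inj₁; inj₂)
  symm : ∀ {x y} → RPAdj G H r x y → RPAdj G H r y x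
  symm (inj₁ (e , h)) = inj₁ (sym e , Graph.adj-sym H h)
  symm (inj₂ (e₁ , e₂ , g)) = inj₂ (e₂ , e₁ , Graph.adj-sym G g)
  irr : ∀ {x} → ¬ RPAdj G H r x x
  irr (inj₁ (_ , h)) = Graph.adj-irrefl H h
  irr (inj₂ (_ , _ , g)) = Graph.adj-irrefl G g

module Submission where

-- Vertex x of G ∘ H is the pair (copy x , base x) = remQuot m x, i.e. vertex
-- base x of the copy H_{copy x}; a subset D of G ∘ H splits into the n slices
-- D_j ⊆ V(H).  For a connected dominating set D of G ∘ H we show:
--   (1) D meets every copy (a non-root vertex is dominated inside its copy),
--       so, as D is connected and there are two copies, every root (j , v)
--       lies in D: a walk leaving copy j must pass through its root;
--   (2) hence every slice D_j is a connected dominating set of H (collapse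
--       all other copies onto v to project walks), so |D_j| ≥ γ_c(H).
-- Conversely, n copies of any connected dominating set S ∋ v of H form a
-- connected dominating set of G ∘ H of size n·|S|; applied to a minimum one
-- with v added, and to a slice, it gives the upper bounds.  As |D| = Σ_j |D_j|
-- the theorem is a counting dichotomy: either some slice is minimum
-- (|D| = n·γ_c(H)), or all slices exceed γ_c(H) (|D| = n·(γ_c(H) + 1)).

open import Defs
open import Data.Nat using (ℕ; zero; suc; _≤_; _*_; _+_; z≤n; s≤s; _≤?_)
open import Data.Nat.Properties
  using (≤-trans; ≤-reflexive; ≤-antisym; +-mono-≤; +-monoʳ-≤; *-monoʳ-≤;
         +-assoc; +-comm; +-suc; n≤1+n; ≰⇒>)
open import Data.Bool using (Bool; true; false)
open import Data.Fin using (Fin; zero; suc; combine; quotient; remainder; remQuot; punchIn; _↑ˡ_; _↑ʳ_)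
open import Data.Fin.Properties using (remQuot-combine; combine-remQuot; punchInᵢ≢i; any?)
  renaming (_≟_ to _≟ᶠ_)
open import Data.Fin.Subset using (Subset; ∣_∣; _∈_; _⊆_; ⁅_⁆; _∪_)
open import Data.Fin.Subset.Properties using (_∈?_; p⊆p∪q; q⊆p∪q; x∈⁅x⁆; ∣⁅x⁆∣≡1; ∈⊤)
open import Data.Vec using ([]; _∷_; lookup; tabulate)
open import Data.Vec.Properties using (lookup∘tabulate; tabulate-cong; tabulate∘lookup; []=⇒lookup; lookup⇒[]=)
open import Data.Product using (∃; _×_; _,_; proj₁; proj₂)
open import Data.Sum using (_⊎_; inj₁; inj₂)
open import Data.Empty using (⊥-elim)
open import Relation.Nullary using (yes; no)
open import Relation.Binary.PropositionalEquality

∑ : (k : ℕ) → (Fin k → ℕ) → ℕ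
∑ zero    f = 0
∑ (suc k) f = f zero + ∑ k (λ i → f (suc i))

∑-cong : ∀ k {f g : Fin k → ℕ} → (∀ i → f i ≡ g i) → ∑ k f ≡ ∑ k g
∑-cong zero    f≡g = refl
∑-cong (suc k) f≡g = cong₂ _+_ (f≡g zero) (∑-cong k (λ i → f≡g (suc i)))

∑-const : ∀ k c → ∑ k (λ _ → c) ≡ k * c
∑-const zero    c = refl
∑-const (suc k) c = cong (c +_) (∑-const k c)

∑-lower : ∀ k c (f : Fin k → ℕ) → (∀ i → c ≤ f i) → k * c ≤ ∑ k f
∑-lower zero    c f c≤f = z≤n
∑-lower (suc k) c f c≤f = +-mono-≤ (c≤f zero) (∑-lower k c (λ i → f (suc i)) (λ i → c≤f (suc i)))

∑-++ : ∀ k l (f : Fin (k + l) → ℕ) →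
       ∑ (k + l) f ≡ ∑ k (λ i → f (i ↑ˡ l)) + ∑ l (λ i → f (k ↑ʳ i))
∑-++ zero    l f = refl
∑-++ (suc k) l f = trans (cong (f zero +_) (∑-++ k l (λ i → f (suc i))))
                         (sym (+-assoc (f zero) _ _))

∑-combine : ∀ n m (f : Fin (n * m) → ℕ) →
            ∑ (n * m) f ≡ ∑ n (λ j → ∑ m (λ a → f (combine j a)))
∑-combine zero    m f = refl
∑-combine (suc n) m f = trans (∑-++ m (n * m) f)
  (cong (∑ m (λ a → f (a ↑ˡ n * m)) +_) (∑-combine n m (λ x → f (m ↑ʳ x))))

bit : Bool → ℕ
bit true  = 1
bit false = 0

∣p∣≡∑ : ∀ {k} (p : Subset k) → ∣ p ∣ ≡ ∑ k (λ i → bit (lookup p i))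
∣p∣≡∑ []          = refl
∣p∣≡∑ (true ∷ p)  = cong suc (∣p∣≡∑ p)
∣p∣≡∑ (false ∷ p) = ∣p∣≡∑ p

∣p∪q∣≤∣p∣+∣q∣ : ∀ {k} (p q : Subset k) → ∣ p ∪ q ∣ ≤ ∣ p ∣ + ∣ q ∣
∣p∪q∣≤∣p∣+∣q∣ []          []          = z≤n
∣p∪q∣≤∣p∣+∣q∣ (true ∷ p)  (true ∷ q)  =
  s≤s (≤-trans (∣p∪q∣≤∣p∣+∣q∣ p q) (+-monoʳ-≤ ∣ p ∣ (n≤1+n ∣ q ∣)))
∣p∪q∣≤∣p∣+∣q∣ (true ∷ p)  (false ∷ q) = s≤s (∣p∪q∣≤∣p∣+∣q∣ p q)
∣p∪q∣≤∣p∣+∣q∣ (false ∷ p) (true ∷ q)  =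
  ≤-trans (s≤s (∣p∪q∣≤∣p∣+∣q∣ p q)) (≤-reflexive (sym (+-suc ∣ p ∣ ∣ q ∣)))
∣p∪q∣≤∣p∣+∣q∣ (false ∷ p) (false ∷ q) = ∣p∪q∣≤∣p∣+∣q∣ p q

∣⁅x⁆∪p∣≤∣p∣+1 : ∀ {k} (x : Fin k) (p : Subset k) → ∣ ⁅ x ⁆ ∪ p ∣ ≤ ∣ p ∣ + 1
∣⁅x⁆∪p∣≤∣p∣+1 x p = ≤-trans (∣p∪q∣≤∣p∣+∣q∣ ⁅ x ⁆ p)
  (≤-reflexive (trans (cong (_+ ∣ p ∣) (∣⁅x⁆∣≡1 x)) (+-comm 1 ∣ p ∣)))

∈-tabulate : ∀ {k} {f : Fin k → Bool} {x} → f x ≡ true → x ∈ tabulate f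
∈-tabulate {f = f} {x} fx = lookup⇒[]= x _ (trans (lookup∘tabulate f x) fx)

∈-tabulate⁻ : ∀ {k} {f : Fin k → Bool} {x} → x ∈ tabulate f → f x ≡ true
∈-tabulate⁻ {f = f} {x} x∈ = trans (sym (lookup∘tabulate f x)) ([]=⇒lookup x∈)

module Blocks (n m : ℕ) where

  slice : Subset (n * m) → Fin n → Subset m
  slice D j = tabulate (λ a → lookup D (combine j a))

  lift : Subset m → Subset (n * m)
  lift S = tabulate (λ x → lookup S (remainder {n} m x))

  ∣D∣≡∑slice : ∀ D → ∣ D ∣ ≡ ∑ n (λ j → ∣ slice D j ∣)
  ∣D∣≡∑slice D = begin
    ∣ D ∣                                                 ≡⟨ ∣p∣≡∑ D ⟩
    ∑ (n * m) (λ x → bit (lookup D x))                    ≡⟨ ∑-combine n m _ ⟩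
    ∑ n (λ j → ∑ m (λ a → bit (lookup D (combine j a)))) ≡⟨ ∑-cong n (λ j → sym (sliceSize j)) ⟩
    ∑ n (λ j → ∣ slice D j ∣)                             ∎
    where
    open ≡-Reasoning
    sliceSize : ∀ j → ∣ slice D j ∣ ≡ ∑ m (λ a → bit (lookup D (combine j a)))
    sliceSize j = trans (∣p∣≡∑ (slice D j)) (∑-cong m (λ a → cong bit (lookup∘tabulate _ a)))

  slice-lift : ∀ S j → slice (lift S) j ≡ S
  slice-lift S j = trans
    (tabulate-cong (λ a → trans (lookup∘tabulate _ (combine j a))
                                (cong (λ p → lookup S (proj₂ p)) (remQuot-combine j a))))
    (tabulate∘lookup S)

  ∣lift∣ : ∀ S → ∣ lift S ∣ ≡ n * ∣ S ∣
  ∣lift∣ S = begin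
    ∣ lift S ∣                        ≡⟨ ∣D∣≡∑slice (lift S) ⟩
    ∑ n (λ j → ∣ slice (lift S) j ∣)  ≡⟨ ∑-cong n (λ j → cong ∣_∣ (slice-lift S j)) ⟩
    ∑ n (λ _ → ∣ S ∣)                 ≡⟨ ∑-const n ∣ S ∣ ⟩
    n * ∣ S ∣                         ∎
    where open ≡-Reasoning

infixr 5 _++ʷ_

_++ʷ_ : ∀ {k} {G : Graph k} {S x y z} → WalkIn G S x y → WalkIn G S y z → WalkIn G S x z
here _         ++ʷ q = q
step x∈ adj p ++ʷ q = step x∈ adj (p ++ʷ q)

weaken : ∀ {k} {G : Graph k} {S T x y} → S ⊆ T → WalkIn G S x y → WalkIn G T x y
weaken S⊆T (here x∈)         = here (S⊆T x∈)
weaken S⊆T (step x∈ adj rest) = step (S⊆T x∈) adj (weaken S⊆T rest)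

mapWalk : ∀ {k l} {G : Graph k} {H : Graph l} {S : Subset k} {T : Subset l} (f : Fin k → Fin l) →
          (∀ {x} → x ∈ S → f x ∈ T) →
          (∀ {x y} → Adj G x y → f x ≡ f y ⊎ Adj H (f x) (f y)) →
          ∀ {x y} → WalkIn G S x y → WalkIn H T (f x) (f y)
mapWalk f f∈ f-adj (here x∈) = here (f∈ x∈)
mapWalk {H = H} {T = T} f f∈ f-adj {y = y} (step x∈ adj rest) with f-adj adj
... | inj₁ fx≡fy = subst (λ z → WalkIn H T z (f y)) (sym fx≡fy) (mapWalk f f∈ f-adj rest)
... | inj₂ fadj  = step (f∈ x∈) fadj (mapWalk f f∈ f-adj rest)

extendConnected : ∀ {k} {G : Graph k} {S T : Subset k} →
                  InducedConnected G S → S ⊆ T →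
                  (∀ {x} → x ∈ T → x ∈ S ⊎ ∃ λ w → w ∈ S × Adj G x w) →
                  InducedConnected G T
extendConnected {G = G} {S} {T} ((u , u∈) , connS) S⊆T attached =
  (u , S⊆T u∈) , λ x y x∈ y∈ →
    let (s , s∈ , x→s) = enter x∈
        (t , t∈ , t→y) = leave y∈
    in x→s ++ʷ weaken S⊆T (connS s t s∈ t∈) ++ʷ t→y
  where
  enter : ∀ {x} → x ∈ T → ∃ λ s → s ∈ S × WalkIn G T x s
  enter x∈ with attached x∈
  ... | inj₁ x∈S           = _ , x∈S , here x∈
  ... | inj₂ (w , w∈ , xw) = w , w∈ , step x∈ xw (here (S⊆T w∈))

  leave : ∀ {y} → y ∈ T → ∃ λ t → t ∈ S × WalkIn G T t y
  leave y∈ with attached y∈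
  ... | inj₁ y∈S           = _ , y∈S , here y∈
  ... | inj₂ (w , w∈ , yw) = w , w∈ , step (S⊆T w∈) (Graph.adj-sym G yw) (here y∈)

addVertexCDS : ∀ {k} {H : Graph k} {S} (v : Fin k) →
               ConnectedDominatingSet H S → ConnectedDominatingSet H (⁅ v ⁆ ∪ S)
addVertexCDS {H = H} {S} v (domS , connS) = dom , extendConnected connS S⊆ attached
  where
  S⊆ : S ⊆ ⁅ v ⁆ ∪ S
  S⊆ = q⊆p∪q ⁅ v ⁆ S

  dom : Dominating H (⁅ v ⁆ ∪ S)
  dom x x∉ with domS x (λ x∈ → x∉ (S⊆ x∈))
  ... | w , w∈ , xw = w , S⊆ w∈ , xw

  attached : ∀ {x} → x ∈ ⁅ v ⁆ ∪ S → x ∈ S ⊎ ∃ λ w → w ∈ S × Adj H x w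
  attached {x} _ with x ∈? S
  ... | yes x∈S = inj₁ x∈S
  ... | no  x∉S = inj₂ (domS x x∉S)

anotherElement : ∀ {k} (x : Fin (suc (suc k))) → ∃ λ y → y ≢ x
anotherElement x = punchIn x zero , punchInᵢ≢i x zero

module RootedProduct {n m : ℕ} (G : Graph n) (H : Graph m) (v : Fin m) where

  open Blocks n m

  RP : Graph (n * m)
  RP = rootedProduct G H v

  copy : Fin (n * m) → Fin n
  copy = quotient {n} m

  base : Fin (n * m) → Fin m
  base = remainder {n} m

  copy-combine : ∀ (j : Fin n) a → copy (combine j a) ≡ j
  copy-combine j a = cong proj₁ (remQuot-combine j a)

  base-combine : ∀ (j : Fin n) a → base (combine j a) ≡ a
  base-combine j a = cong proj₂ (remQuot-combine j a)

  ≡combine : ∀ {x} {j : Fin n} {a} → copy x ≡ j → base x ≡ a → combine j a ≡ x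
  ≡combine {x} refl refl = combine-remQuot {n} m x

  rp-adj : ∀ {x y p q} → remQuot {n} m x ≡ p → remQuot {n} m y ≡ q → RPAdj G H v p q → Adj RP x y
  rp-adj refl refl adj = adj

  rp-adj⁻ : ∀ {x y p q} → remQuot {n} m x ≡ p → remQuot {n} m y ≡ q → Adj RP x y → RPAdj G H v p q
  rp-adj⁻ refl refl adj = adj

  copyEdge : ∀ (j : Fin n) {a b} → Adj H a b → Adj RP (combine j a) (combine j b)
  copyEdge j {a} {b} ab = rp-adj (remQuot-combine j a) (remQuot-combine j b) (inj₁ (refl , ab))

  rootEdge : ∀ {i j : Fin n} → Adj G i j → Adj RP (combine i v) (combine j v)
  rootEdge {i} {j} ij = rp-adj (remQuot-combine i v) (remQuot-combine j v) (inj₂ (refl , refl , ij))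

  ∈slice : ∀ {D} {j : Fin n} {a} → combine j a ∈ D → a ∈ slice D j
  ∈slice a∈ = ∈-tabulate ([]=⇒lookup a∈)

  ∈slice⁻ : ∀ {D} {j : Fin n} {a} → a ∈ slice D j → combine j a ∈ D
  ∈slice⁻ {D} {j} {a} a∈ = lookup⇒[]= (combine j a) D (∈-tabulate⁻ a∈)

  ∈lift : ∀ {S x} → base x ∈ S → x ∈ lift S
  ∈lift x∈ = ∈-tabulate ([]=⇒lookup x∈)

  ∈lift⁻ : ∀ {S x} → x ∈ lift S → base x ∈ S
  ∈lift⁻ {S} {x} x∈ = lookup⇒[]= (base x) S (∈-tabulate⁻ x∈)

  liftCDS : ∀ {S} → Connected G → ConnectedDominatingSet H S → v ∈ S →
            ConnectedDominatingSet RP (lift S)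
  liftCDS {S} ((i , _) , connG) (domS , _ , connS) v∈S = dom , (combine i v , inCopy v∈S) , conn
    where
    inCopy : ∀ {j : Fin n} {a} → a ∈ S → combine j a ∈ lift S
    inCopy {j} {a} a∈ = ∈lift (subst (_∈ S) (sym (base-combine j a)) a∈)

    dom : Dominating RP (lift S)
    dom x x∉ with domS (base x) (λ b∈ → x∉ (∈lift b∈))
    ... | w , w∈ , bw = combine (copy x) w , inCopy w∈ ,
                        rp-adj refl (remQuot-combine (copy x) w) (inj₁ (refl , bw))

    inH : ∀ (j : Fin n) {a b} → WalkIn H S a b → WalkIn RP (lift S) (combine j a) (combine j b)
    inH j = mapWalk (combine j) inCopy (λ ab → inj₂ (copyEdge j ab))

    alongG : ∀ {j j' : Fin n} → WalkIn G full j j' → WalkIn RP (lift S) (combine j v) (combine j' v)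
    alongG = mapWalk (λ j → combine j v) (λ _ → inCopy v∈S) (λ jj' → inj₂ (rootEdge jj'))

    conn : ∀ x y → x ∈ lift S → y ∈ lift S → WalkIn RP (lift S) x y
    conn x y x∈ y∈ = subst₂ (WalkIn RP (lift S)) (≡combine refl refl) (≡combine refl refl)
      (inH (copy x) (connS (base x) v (∈lift⁻ x∈) v∈S)
        ++ʷ alongG (connG (copy x) (copy y) ∈⊤ ∈⊤)
        ++ʷ inH (copy y) (connS v (base y) v∈S (∈lift⁻ y∈)))

  module CDSOf (D : Subset (n * m)) (cdsD : ConnectedDominatingSet RP D) where

    domD : Dominating RP D
    domD = proj₁ cdsD

    connD : ∀ x y → x ∈ D → y ∈ D → WalkIn RP D x y
    connD = proj₂ (proj₂ cdsD)

    inSlice : ∀ {x} {j : Fin n} → copy x ≡ j → x ∈ D → combine j (base x) ∈ D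
    inSlice x∈j x∈ = subst (_∈ D) (sym (≡combine x∈j refl)) x∈

    -- A non-root vertex is dominated from inside its own copy.
    copyMeets : ∀ (j : Fin n) {a} → a ≢ v → ∃ λ b → combine j b ∈ D
    copyMeets j {a} a≢v with combine j a ∈? D
    ... | yes a∈ = a , a∈
    ... | no  a∉ with domD (combine j a) a∉
    ... | w , w∈ , aw with rp-adj⁻ (remQuot-combine j a) refl aw
    ...   | inj₁ (j≡copy , _) = base w , inSlice (sym j≡copy) w∈
    ...   | inj₂ (a≡v , _)    = ⊥-elim (a≢v a≡v)

    -- The only edges leaving a copy are at its root.
    leavingCopy : ∀ (j : Fin n) {x y} → WalkIn RP D x y →
                  copy x ≡ j → copy y ≢ j → combine j v ∈ D
    leavingCopy j (here _) x∈j y∉j = ⊥-elim (y∉j x∈j)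
    leavingCopy j (step x∈ (inj₁ (same , _)) rest) x∈j y∉j =
      leavingCopy j rest (trans (sym same) x∈j) y∉j
    leavingCopy j (step {x} x∈ (inj₂ (x≡v , _)) _) x∈j _ =
      subst (_∈ D) (sym (≡combine x∈j x≡v)) x∈

    rootsIn : (∃ λ a → a ≢ v) → (∀ j → ∃ λ j' → j' ≢ j) → ∀ j → combine j v ∈ D
    rootsIn (a , a≢v) another j =
      let (j' , j'≢j) = another j
          (b , b∈)    = copyMeets j a≢v
          (b' , b'∈)  = copyMeets j' a≢v
      in leavingCopy j (connD _ _ b∈ b'∈) (copy-combine j b)
                     (λ e → j'≢j (trans (sym (copy-combine j' b')) e))

    module _ (j : Fin n) (root : combine j v ∈ D) where

      collapse : Fin (n * m) → Fin m
      collapse x with copy x ≟ᶠ j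
      ... | yes _ = base x
      ... | no  _ = v

      collapse-∈ : ∀ {x} → x ∈ D → collapse x ∈ slice D j
      collapse-∈ {x} x∈ with copy x ≟ᶠ j
      ... | yes x∈j = ∈slice (inSlice x∈j x∈)
      ... | no  _   = ∈slice root

      collapse-combine : ∀ a → collapse (combine j a) ≡ a
      collapse-combine a with copy (combine j a) ≟ᶠ j
      ... | yes _   = base-combine j a
      ... | no  ≢j  = ⊥-elim (≢j (copy-combine j a))

      collapse-root : ∀ {x} → base x ≡ v → collapse x ≡ v
      collapse-root {x} x≡v with copy x ≟ᶠ j
      ... | yes _ = x≡v
      ... | no  _ = refl

      collapse-adj : ∀ {x y} → Adj RP x y →
                     collapse x ≡ collapse y ⊎ Adj H (collapse x) (collapse y)
      collapse-adj {x} {y} (inj₂ (x≡v , y≡v , _)) =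
        inj₁ (trans (collapse-root x≡v) (sym (collapse-root y≡v)))
      collapse-adj {x} {y} (inj₁ (same , xy)) with copy x ≟ᶠ j | copy y ≟ᶠ j
      ... | yes _   | yes _   = inj₂ xy
      ... | yes x∈j | no  y∉j = ⊥-elim (y∉j (trans (sym same) x∈j))
      ... | no  x∉j | yes y∈j = ⊥-elim (x∉j (trans same y∈j))
      ... | no  _   | no  _   = inj₁ refl

      -- A vertex of copy j outside D is dominated within copy j unless it is the root, which lies in D.
      sliceDominating : Dominating H (slice D j)
      sliceDominating a a∉ with domD (combine j a) (λ a∈ → a∉ (∈slice a∈))
      ... | w , w∈ , aw with rp-adj⁻ (remQuot-combine j a) refl aw
      ...   | inj₁ (j≡copy , ab) = base w , ∈slice (inSlice (sym j≡copy) w∈) , ab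
      ...   | inj₂ (a≡v , _)     = ⊥-elim (a∉ (subst (_∈ slice D j) (sym a≡v) (∈slice root)))

      -- Slice j of D is a connected dominating set of H: walks in D collapse onto it.
      sliceCDS : ConnectedDominatingSet H (slice D j)
      sliceCDS = sliceDominating , (v , ∈slice root) , λ a b a∈ b∈ →
        subst₂ (WalkIn H (slice D j)) (collapse-combine a) (collapse-combine b)
          (mapWalk collapse collapse-∈ collapse-adj (connD _ _ (∈slice⁻ a∈) (∈slice⁻ b∈)))

dichotomy : ∀ k c t (f : Fin k → ℕ) → t ≡ ∑ k f → (∀ i → c ≤ f i) →
            (∀ i → f i ≤ c → t ≤ k * c) → t ≤ k * (c + 1) →
            t ≡ k * c ⊎ t ≡ k * (c + 1)
dichotomy k c t f t≡∑ c≤f small⇒ t≤ with any? (λ i → f i ≤? c)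
... | yes (i , fi≤c) =
  inj₁ (≤-antisym (small⇒ i fi≤c) (subst (k * c ≤_) (sym t≡∑) (∑-lower k c f c≤f)))
... | no ¬small =
  inj₂ (≤-antisym t≤ (subst (k * (c + 1) ≤_) (sym t≡∑) (∑-lower k (c + 1) f large)))
  where
  large : ∀ i → c + 1 ≤ f i
  large i = subst (_≤ f i) (+-comm 1 c) (≰⇒> (λ fi≤c → ¬small (i , fi≤c)))

mainTheorem8 : (n m : ℕ) → 2 ≤ n → 2 ≤ m →
    (G : Graph n) → (H : Graph m) → (v : Fin m) →
    Connected G → Connected H →
    (D : Subset (n * m)) → IsMinCDS (rootedProduct G H v) D →
    (DH : Subset m) → IsMinCDS H DH →
    (∣ D ∣ ≡ n * ∣ DH ∣) ⊎ (∣ D ∣ ≡ n * (∣ DH ∣ + 1))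
mainTheorem8 n@(suc (suc _)) m@(suc (suc _)) (s≤s (s≤s z≤n)) (s≤s (s≤s z≤n))
             G H v cG _ D (cdsD , minD) DH (cdsDH , minDH) =
  dichotomy n ∣ DH ∣ ∣ D ∣ (λ j → ∣ slice D j ∣) (∣D∣≡∑slice D)
    (λ j → minDH _ (sliceCDS j (root j)))
    -- a slice of size ≤ γ_c(H), lifted, bounds D by n·γ_c(H)
    (λ j small → ≤-trans (belowLift (sliceCDS j (root j)) (∈slice {j = j} (root j)))
                         (*-monoʳ-≤ n small))
    -- a minimum connected dominating set of H with v added bounds D by n·(γ_c(H) + 1)
    (≤-trans (belowLift (addVertexCDS v cdsDH) (p⊆p∪q DH (x∈⁅x⁆ v)))
             (*-monoʳ-≤ n (∣⁅x⁆∪p∣≤∣p∣+1 v DH)))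
  where
  open Blocks n m
  open RootedProduct G H v
  open CDSOf D cdsD

  root : ∀ j → combine j v ∈ D
  root = rootsIn (anotherElement v) anotherElement

  belowLift : ∀ {S} → ConnectedDominatingSet H S → v ∈ S → ∣ D ∣ ≤ n * ∣ S ∣
  belowLift {S} cdsS v∈S = subst (∣ D ∣ ≤_) (∣lift∣ S) (minD _ (liftCDS cG cdsS v∈S))
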